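{- For every $n\ge 0$, the list $\mathcal{S}_n$ defined below consists of all Schröder paths from $(0,0)$ to $(2n,0)$, i.e. every entry of $\mathcal{S}_n$ is such a path and every such path occurs in $\mathcal{S}_n$.
   Context: A Schröder path from $(0,0)$ to $(2n,0)$ is a lattice path using steps $\mathsf{u}=(1,1)$, $\mathsf{d}=(1,-1)$ and $\mathsf{e}=(2,0)$ that never goes below the $x$-axis; it is written as a word in $\mathsf{u},\mathsf{d},\mathsf{e}$. The large Schröder numbers are given by $r_0=1$ and $r_n=r_{n-1}+\sum_{k=1}^n r_{k-1}r_{n-k}$ for $n>0$. Let $B(1)=0$ and $B(i)=r_0+\cdots+r_{i-2}$ for $i>1$. The $j$-th entry of a list $\mathcal{S}_n$ is $\mathcal{S}_n(j)$; for an integer $i$, $\mathcal{S}_n^i(j)=\mathcal{S}_n(j)$ if $i$ is odd and $\mathcal{S}_n^i(j)=\mathcal{S}_n(r_n+1-j)$ if $i$ is even. $\bigoplus$ denotes concatenation of lists in index order (outer index varying slowest), juxtaposition denotes concatenation of words. Let $\mathcal{S}_0=(\emptyset)$ (the empty path), and for $n\ge1$ $$\mathcal{S}_n=\bigoplus_{i=1}^{r_{n-1}}\big(\mathsf{e}\,\mathcal{S}_{n-1}(i)\big)\ \oplus\ \bigoplus_{i=1}^{n}\bigoplus_{j=1}^{r_{i-1}}\bigoplus_{k=1}^{r_{n-i}}\big(\mathsf{u}\,\mathcal{S}_{i-1}^{\,n+i}(j)\,\mathsf{d}\,\mathcal{S}_{n-i}^{\,j+B(i)+1}(k)\big).$$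 -}

module Defs where

open import Data.Nat using (ℕ; zero; suc; _+_; _*_; _∸_)
open import Data.Bool using (Bool; true; false; if_then_else_)
open import Data.List using (List; []; _∷_; _++_; map; concat; reverse; upTo; length; zip; _∷ʳ_)
open import Data.Nat.ListAction using (sum)
open import Data.Product using (_×_; _,_)
open import Relation.Binary.PropositionalEquality using (_≡_)

-- Steps u = (1,1), d = (1,-1), e = (2,0)
data Step : Set where
  u d e : Step

Path : Set
Path = List Step

width : Path → ℕ
width []      = 0
width (u ∷ w) = 1 + width w
width (d ∷ w) = 1 + width w
width (e ∷ w) = 2 + width w

-- Walk h w : reading w from height h, the path never goes below the x-axis
-- and ends at height 0.
data Walk : ℕ → Path → Set where
  done : Walk 0 []
  up   : ∀ {h w} → Walk (suc h) w → Walk h (u ∷ w)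
  down : ∀ {h w} → Walk h w → Walk (suc h) (d ∷ w)
  flat : ∀ {h w} → Walk h w → Walk h (e ∷ w)

IsSchroder : ℕ → Path → Set
IsSchroder n w = Walk 0 w × width w ≡ 2 * n

-- lookup with default (only ever used in range)
nth : {A : Set} → A → List A → ℕ → A
nth a []       _       = a
nth a (x ∷ xs) zero    = x
nth a (x ∷ xs) (suc k) = nth a xs k

Σ1 : ℕ → (ℕ → ℕ) → ℕ
Σ1 zero    f = 0
Σ1 (suc m) f = Σ1 m f + f (suc m)

-- table [r_0, ..., r_n] of large Schröder numbers
rTable : ℕ → List ℕ
rTable zero    = 1 ∷ []
rTable (suc n) = t ∷ʳ (rr n + Σ1 (suc n) (λ k → rr (k ∸ 1) * rr (suc n ∸ k)))
  where
  t = rTable n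
  rr : ℕ → ℕ
  rr = nth 0 t

r : ℕ → ℕ
r n = nth 0 (rTable n) n

B : ℕ → ℕ
B i = sum (map r (upTo (i ∸ 1)))

odd : ℕ → Bool
odd zero          = false
odd (suc zero)    = true
odd (suc (suc k)) = odd k

-- the list S_m^i : S_m if i odd, S_m read backwards (S_m(r_m+1-j)) if i even
orient : ℕ → List Path → List Path
orient i xs = if odd i then xs else reverse xs

indexed : {A : Set} → List A → List (ℕ × A)
indexed xs = zip (map suc (upTo (length xs))) xs

-- one step of the recursive definition; `prev m` is S_m for m < n
step : (n : ℕ) → (ℕ → List Path) → List Path
step zero    prev = [] ∷ []
step (suc n') prev =
  map (e ∷_) (prev n')
  ++ concat (map (λ i →
       concat (map (λ { (j , p) →
         map (λ q → u ∷ (p ++ (d ∷ q)))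
             (orient (j + B i + 1) (prev (n ∸ i))) })
         (indexed (orient (n + i) (prev (i ∸ 1))))))
       (map suc (upTo n)))
  where
  n = suc n'

STable : ℕ → List (List Path)
STable zero    = ([] ∷ []) ∷ []
STable (suc n) = t ∷ʳ step (suc n) (nth [] t)
  where t = STable n

S : ℕ → List Path
S n = nth [] (STable n) n

module Submission where

-- Up to membership, the orientations and index shifts in the definition of S only permute
-- blocks, so S (suc n) contains exactly e S n together with u S a d S b for a + b = n.
-- Cutting a Schröder path at its first step (and, if it is u, at the first return to the
-- axis) gives the same decomposition, so both inclusions follow by strong induction on n.

open import Defs
open import Data.Nat using (ℕ; zero; suc; _+_; _*_; _∸_; _≤_; _<_; z≤n; s≤s)
open import Data.Nat.Properties
open import Data.Nat.Induction using (<-rec)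
open import Data.Product using (_×_; _,_; ∃; ∃₂; proj₁; proj₂)
open import Data.Bool using (true; false)
open import Data.List using (List; []; _∷_; _++_; map; upTo; length; zip; _∷ʳ_)
open import Data.List.Properties using (length-map; length-upTo; length-++)
open import Data.List.Membership.Propositional using (_∈_; find; lose)
open import Data.List.Membership.Propositional.Properties
open import Data.List.Relation.Unary.Any using (here; there)
open import Data.List.Relation.Unary.Any.Properties using (reverse⁺; reverse⁻)
open import Data.Sum using (inj₁; inj₂)
open import Relation.Binary.PropositionalEquality

private variable
  A X : Set
  n m a b h k : ℕ
  w p q : Path

∈-zip⁻ʳ : ∀ {x : A} {y : X} (xs : List A) (ys : List X) → (x , y) ∈ zip xs ys → y ∈ ys
∈-zip⁻ʳ (_ ∷ _)  (_ ∷ _)  (here refl) = here refl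
∈-zip⁻ʳ (_ ∷ xs) (_ ∷ ys) (there xy∈) = there (∈-zip⁻ʳ xs ys xy∈)

∈-zip⁺ʳ : ∀ {y : X} (xs : List A) (ys : List X) → length ys ≤ length xs →
          y ∈ ys → ∃ λ x → (x , y) ∈ zip xs ys
∈-zip⁺ʳ (x ∷ _)  (_ ∷ _)  _         (here refl) = x , here refl
∈-zip⁺ʳ (_ ∷ xs) (_ ∷ ys) (s≤s len) (there y∈)  =
  let x , xy∈ = ∈-zip⁺ʳ xs ys len y∈ in x , there xy∈

∈-indexed⁻ : ∀ {j} {x : A} xs → (j , x) ∈ indexed xs → x ∈ xs
∈-indexed⁻ xs = ∈-zip⁻ʳ (map suc (upTo (length xs))) xs

∈-indexed⁺ : ∀ {x : A} xs → x ∈ xs → ∃ λ j → (j , x) ∈ indexed xs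
∈-indexed⁺ xs = ∈-zip⁺ʳ (map suc (upTo (length xs))) xs
  (≤-reflexive (sym (trans (length-map suc (upTo (length xs))) (length-upTo (length xs)))))

∈-orient⁺ : ∀ i {xs : List Path} → w ∈ xs → w ∈ orient i xs
∈-orient⁺ i w∈ with odd i
... | true  = w∈
... | false = reverse⁺ w∈

∈-orient⁻ : ∀ i {xs : List Path} → w ∈ orient i xs → w ∈ xs
∈-orient⁻ i w∈ with odd i
... | true  = w∈
... | false = reverse⁻ w∈

nth-∷ʳ-< : ∀ {z x : A} xs → k < length xs → nth z (xs ∷ʳ x) k ≡ nth z xs k
nth-∷ʳ-< {k = zero}  (_ ∷ _)  _         = refl
nth-∷ʳ-< {k = suc k} (_ ∷ xs) (s≤s k<) = nth-∷ʳ-< xs k<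

nth-∷ʳ-length : ∀ {z x : A} xs → nth z (xs ∷ʳ x) (length xs) ≡ x
nth-∷ʳ-length []       = refl
nth-∷ʳ-length (_ ∷ xs) = nth-∷ʳ-length xs

length-STable : ∀ n → length (STable n) ≡ suc n
length-STable zero    = refl
length-STable (suc n) = begin
  length (STable n ∷ʳ _)      ≡⟨ length-++ (STable n) ⟩
  length (STable n) + 1       ≡⟨ cong (_+ 1) (length-STable n) ⟩
  suc n + 1                   ≡⟨ +-comm (suc n) 1 ⟩
  suc (suc n)                 ∎
  where open ≡-Reasoning

nth-STable : m ≤ n → nth [] (STable n) m ≡ S m
nth-STable {n = zero} z≤n = refl
nth-STable {m} {suc n} m≤ with m≤n⇒m<n∨m≡n m≤
... | inj₂ refl      = refl
... | inj₁ (s≤s m≤n) = trans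
  (nth-∷ʳ-< (STable n) (subst (m <_) (sym (length-STable n)) (s≤s m≤n)))
  (nth-STable m≤n)

S-suc : ∀ n → S (suc n) ≡ step (suc n) (nth [] (STable n))
S-suc n = trans (cong (nth [] (STable (suc n))) (sym (length-STable n)))
                (nth-∷ʳ-length (STable n))

Listed : (ℕ → List Path) → ℕ → Path → Set
Listed f m w = w ∈ f m

-- Paths of semilength suc n, cut at their first step (and at the first return after a u).
data Decomposed (P : ℕ → Path → Set) (n : ℕ) : Path → Set where
  e-first : P n w → Decomposed P n (e ∷ w)
  u-first : a + b ≡ n → P a p → P b q → Decomposed P n (u ∷ p ++ d ∷ q)

Decomposed-map : ∀ {P Q : ℕ → Path → Set} →
  (∀ {m w} → m ≤ n → P m w → Q m w) → Decomposed P n w → Decomposed Q n w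
Decomposed-map f (e-first Pw) = e-first (f ≤-refl Pw)
Decomposed-map f (u-first refl Pp Pq) = u-first refl (f (m≤m+n _ _) Pp) (f (m≤n+m _ _) Pq)

∈-step⁻ : ∀ {prev} → w ∈ step (suc n) prev → Decomposed (Listed prev) n w
∈-step⁻ {n = n} {prev = prev} w∈ with ∈-++⁻ (map (e ∷_) (prev n)) w∈
... | inj₁ w∈e with v , v∈ , refl ← ∈-map⁻ (e ∷_) w∈e = e-first v∈
... | inj₂ w∈u
  with i , i∈ , w∈i ← find (∈-concatMap⁻ _ {xs = map suc (upTo (suc n))} w∈u)
  with a , a∈ , refl ← ∈-map⁻ suc i∈
  with (j , p) , jp∈ , w∈j ← find (∈-concatMap⁻ _ {xs = indexed (orient (suc n + suc a) (prev a))} w∈i)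
  with q , q∈ , refl ← ∈-map⁻ _ w∈j
  = u-first (m+[n∸m]≡n (≤-pred (∈-upTo⁻ a∈)))
            (∈-orient⁻ (suc n + suc a) (∈-indexed⁻ _ jp∈))
            (∈-orient⁻ (j + B (suc a) + 1) q∈)

∈-step⁺ : ∀ {prev} → Decomposed (Listed prev) n w → w ∈ step (suc n) prev
∈-step⁺ (e-first w∈) = ∈-++⁺ˡ (∈-map⁺ (e ∷_) w∈)
∈-step⁺ {prev = prev} (u-first {a} {b} refl p∈ q∈)
  with j , jp∈ ← ∈-indexed⁺ _ (∈-orient⁺ (suc (a + b) + suc a) p∈) =
  ∈-++⁺ʳ (map (e ∷_) (prev (a + b)))
    (∈-concatMap⁺ _ {xs = map suc (upTo (suc (a + b)))}
      (lose (∈-map⁺ suc (∈-upTo⁺ (s≤s (m≤m+n a b))))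
        (∈-concatMap⁺ _ {xs = indexed (orient (suc (a + b) + suc a) (prev a))}
          (lose jp∈ (∈-map⁺ _ (∈-orient⁺ (j + B (suc a) + 1)
            (subst (λ c → Listed prev c _) (sym (m+n∸m≡n a b)) q∈)))))))

∈-S-suc⁻ : w ∈ S (suc n) → Decomposed (Listed S) n w
∈-S-suc⁻ {w} {n} w∈ =
  Decomposed-map (λ m≤n → subst (_ ∈_) (nth-STable m≤n)) (∈-step⁻ (subst (w ∈_) (S-suc n) w∈))

∈-S-suc⁺ : Decomposed (Listed S) n w → w ∈ S (suc n)
∈-S-suc⁺ {n} {w} dw =
  subst (w ∈_) (sym (S-suc n))
    (∈-step⁺ (Decomposed-map (λ m≤n → subst (_ ∈_) (sym (nth-STable m≤n))) dw))

walk-++ : Walk h p → Walk k q → Walk (h + k) (p ++ q)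
walk-++ done     Wq = Wq
walk-++ (up W)   Wq = up (walk-++ W Wq)
walk-++ (down W) Wq = down (walk-++ W Wq)
walk-++ (flat W) Wq = flat (walk-++ W Wq)

width-++ : ∀ p q → width (p ++ q) ≡ width p + width q
width-++ []      q = refl
width-++ (u ∷ p) q = cong suc (width-++ p q)
width-++ (d ∷ p) q = cong suc (width-++ p q)
width-++ (e ∷ p) q = cong (2 +_) (width-++ p q)

walk-width-even : Walk h w → ∃ λ m → width w + h ≡ 2 * m
walk-width-even done = 0 , refl
walk-width-even {w = u ∷ w} (up W) =
  let m , eq = walk-width-even W in m , trans (sym (+-suc (width w) _)) eq
walk-width-even {w = d ∷ w} (down {h} W) =
  let m , eq = walk-width-even W in
  suc m , trans (cong suc (+-suc (width w) h)) (trans (cong (2 +_) eq) (sym (*-suc 2 m)))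
walk-width-even (flat W) =
  let m , eq = walk-width-even W in suc m , trans (cong (2 +_) eq) (sym (*-suc 2 m))

-- Splits at the first step down from height suc h to h.
walk-split : ∀ k {h} w → Walk (k + suc h) w →
  ∃₂ λ p q → w ≡ p ++ d ∷ q × Walk k p × Walk h q
walk-split zero    [] ()
walk-split (suc k) [] ()
walk-split k (u ∷ w) (up W)
  with p , q , refl , Wp , Wq ← walk-split (suc k) w W = u ∷ p , q , refl , up Wp , Wq
walk-split zero (d ∷ w) (down W) = [] , w , refl , done , W
walk-split (suc k) (d ∷ w) (down W)
  with p , q , refl , Wp , Wq ← walk-split k w W = d ∷ p , q , refl , down Wp , Wq
walk-split k (e ∷ w) (flat W)
  with p , q , refl , Wp , Wq ← walk-split k w W = e ∷ p , q , refl , flat Wp , Wq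

width-u-first : ∀ p q → width p ≡ 2 * a → width q ≡ 2 * b →
                width (u ∷ p ++ d ∷ q) ≡ 2 * suc (a + b)
width-u-first {a} {b} p q wp wq = begin
  width (u ∷ p ++ d ∷ q)         ≡⟨ cong suc (width-++ p (d ∷ q)) ⟩
  suc (width p + suc (width q))  ≡⟨ cong suc (+-suc (width p) (width q)) ⟩
  2 + (width p + width q)        ≡⟨ cong₂ (λ x y → 2 + (x + y)) wp wq ⟩
  2 + (2 * a + 2 * b)            ≡⟨ cong (2 +_) (*-distribˡ-+ 2 a b) ⟨
  2 + 2 * (a + b)                ≡⟨ *-suc 2 (a + b) ⟨
  2 * suc (a + b)                ∎
  where open ≡-Reasoning

schroder-zero : IsSchroder 0 w → w ≡ []
schroder-zero {[]}    _       = refl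
schroder-zero {u ∷ _} (_ , ())
schroder-zero {e ∷ _} (_ , ())

decomposed-schroder : Decomposed IsSchroder n w → IsSchroder (suc n) w
decomposed-schroder {n} (e-first (W , wd)) = flat W , trans (cong (2 +_) wd) (sym (*-suc 2 n))
decomposed-schroder (u-first {a} {b} {p} {q} refl (Wp , wp) (Wq , wq)) =
  up (walk-++ Wp (down Wq)) , width-u-first {a} {b} p q wp wq

-- The first return to the axis is the first step down from height 1.
schroder-decompose : IsSchroder (suc n) w → Decomposed IsSchroder n w
schroder-decompose {w = []} (_ , ())
schroder-decompose {n} {e ∷ w} (flat W , wd) =
  e-first (W , +-cancelˡ-≡ 2 _ _ (trans wd (*-suc 2 n)))
schroder-decompose {n} {u ∷ w} (up W , wd)
  with p , q , refl , Wp , Wq ← walk-split 0 w W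
  with a , wp ← walk-width-even Wp
  with b , wq ← walk-width-even Wq
  = u-first {a = a} {b = b} a+b≡n (Wp , wp′) (Wq , wq′)
  where
  wp′ : width p ≡ 2 * a
  wp′ = trans (sym (+-identityʳ (width p))) wp
  wq′ : width q ≡ 2 * b
  wq′ = trans (sym (+-identityʳ (width q))) wq
  a+b≡n : a + b ≡ n
  a+b≡n = suc-injective (*-cancelˡ-≡ _ _ 2 (trans (sym (width-u-first {a} {b} p q wp′ wq′)) wd))

EnumeratesSchroder : ℕ → Set
EnumeratesSchroder n =
  ((w : Path) → w ∈ S n → IsSchroder n w) × ((w : Path) → IsSchroder n w → w ∈ S n)

lemma3p1 : (n : ℕ) →
    ((w : Path) → w ∈ S n → IsSchroder n w) ×
    ((w : Path) → IsSchroder n w → w ∈ S n)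
lemma3p1 = <-rec EnumeratesSchroder enumerates
  where
  enumerates : ∀ n → (∀ {m} → m < n → EnumeratesSchroder m) → EnumeratesSchroder n
  enumerates zero _ =
    (λ { .[] (here refl) → done , refl }) ,
    (λ w sw → subst (_∈ S 0) (sym (schroder-zero sw)) (here refl))
  enumerates (suc n) IH =
    (λ w w∈ → decomposed-schroder (Decomposed-map (λ m≤n → proj₁ (IH (s≤s m≤n)) _) (∈-S-suc⁻ w∈))) ,
    (λ w sw → ∈-S-suc⁺ (Decomposed-map (λ m≤n → proj₂ (IH (s≤s m≤n)) _) (schroder-decompose sw)))
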